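{- Let $\mathcal{T}$ be a consistent typed combinatory algebra. Then the category $\mathbf{ApType}_{\mathcal{T}}$ of apartness types, regarded as a typed combinatory algebra, is extensional and standard, and $|\bot|$ is inhabited in it.
   Context: A typed combinatory algebra (tca) $\mathcal{S}$ consists of a set of types containing distinguished types $\bot,\top,N$ and closed under binary operations $\times,\to,+$; for each type $T$ a set $|T|$; and total application maps $|S\to T|\times|S|\to|T|$, $(a,b)\mapsto ab$, such that for all types $S,T,U$ there are elements $\mathsf{exf}\in|\bot\to S|$, $\mathsf{t}\in|\top|$, $\mathsf{k}$, $\mathsf{s}$, $\mathsf{pair}\in|S\to T\to S\times T|$, $\mathsf{fst},\mathsf{snd}$, $\mathsf{inl},\mathsf{inr}$, $\mathsf{case}$, $\mathsf{0}\in|N|$, $\mathsf{succ}\in|N\to N|$, $\mathsf{R}\in|S\to(N\to(S\to S))\to(N\to S)|$ with $\mathsf{k}ab=a$, $\mathsf{s}abc=ac(bc)$, $\mathsf{fst}(\mathsf{pair}ab)=a$, $\mathsf{snd}(\mathsf{pair}ab)=b$, $\mathsf{case}ab(\mathsf{inl}x)=ax$, $\mathsf{case}ab(\mathsf{inr}x)=bx$, $\mathsf{R}ab\mathsf{0}=a$, $\mathsf{R}ab(\mathsf{succ}n)=bn(\mathsf{R}abn)$. It is consistent if $\mathsf 0\ne\mathsf{succ}\,\mathsf 0$; standard if $n\mapsto\mathsf{succ}^n\mathsf 0$ is a bijection $\mathbb N\to|N|$; extensional if the maps $|S\times T|\to|S|\times|T|$, $x\mapsto(\mathsf{fst}x,\mathsf{snd}x)$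 and $|T\to S|\to|S|^{|T|}$, $x\mapsto(y\mapsto xy)$ are injective and $\mathsf t$ is the only element of $|\top|$. A $\mathcal{T}$-apartness type is a tuple $(A,T_A,T_A^-,\#_A)$ of types with $|T_A^-|$ inhabited, an inhabited $A\subseteq|T_A|$ and a relation $\#_A\subseteq A\times A\times|T_A^-|$ (write $n:a_0\#_A a_1$) that is irreflexive and for which there are $s\in|T_A\to T_A\to T_A^-\to T_A^-|$ with $n:a_0\#a_1\Rightarrow sa_0a_1n:a_1\#a_0$ and $t\in|T_A\to T_A\to T_A\to T_A^-\to(T_A^-+T_A^-)|$ such that for $n:a_0\#a_1$, $a_2\in A$, $ta_0a_1a_2n$ is $\mathsf{inl}\,m$ with $m:a_0\#a_2$ or $\mathsf{inr}\,m$ with $m:a_1\#a_2$. $a_0\sim_A a_1$ iff no $n$ with $n:a_0\#_A a_1$. Premorphisms $\mathcal A\to\mathcal B$ are $f\in|(T_A\to T_B)\times(T_A\to T_A\to T_B^-\to T_A^-)|$ with $(\mathsf{fst}f)(A)\subseteq B$ and $n:(\mathsf{fst}f)a_0\#_B(\mathsf{fst}f)a_1\Rightarrow(\mathsf{snd}f)a_0a_1n:a_0\#_A a_1$; they are identified when $(\mathsf{fst}f)a\sim_B(\mathsf{fst}g)a$ for all $a\in A$. $\mathbf{ApType}_{\mathcal T}$ is the category of apartness types and equivalence classes of premorphisms; it is a well-pointed cartesian closed category with natural numbers object $(\{\overline n\},N,N,\#)$ ($x:\overline n\#\overline m$ iff $n\ne m$), binary coproducts, and terminal object $(\{\mathsf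 t\},\top,\top,\emptyset)$ which is also weakly initial. It is regarded as a tca with the objects as types, $|X|=\mathrm{Hom}(1,X)$, $\times,\to,+$ the product, exponential and coproduct, $\top$ the terminal object, $\bot$ the weakly initial (terminal) object, $N$ the natural numbers object, application by evaluation, and combinators the canonical morphisms. -}

module Defs where

open import Data.Nat using (ℕ) renaming (zero to zeroℕ; suc to sucℕ)
open import Data.Nat.Properties using (_≟_)
open import Data.Product using (Σ; _×_; _,_; proj₁; proj₂; Σ-syntax)
open import Data.Sum using (_⊎_; inj₁; inj₂)
open import Data.Empty using (⊥; ⊥-elim)
open import Relation.Nullary using (¬_; yes; no)
open import Relation.Binary.PropositionalEquality

record TCA : Set₁ where
  infixr 5 _⇒_
  infixr 6 _+ᵀ_
  infixr 7 _×ᵀ_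
  infixl 9 _·_
  field
    Ty : Set
    ⊥ᵀ ⊤ᵀ Nᵀ : Ty
    _×ᵀ_ _⇒_ _+ᵀ_ : Ty → Ty → Ty
    El : Ty → Set
    _·_ : ∀ {S T} → El (S ⇒ T) → El S → El T
    exf  : ∀ {S} → El (⊥ᵀ ⇒ S)
    t    : El ⊤ᵀ
    k    : ∀ {S T} → El (S ⇒ T ⇒ S)
    s    : ∀ {S T U} → El ((S ⇒ T ⇒ U) ⇒ (S ⇒ T) ⇒ S ⇒ U)
    pair : ∀ {S T} → El (S ⇒ T ⇒ S ×ᵀ T)
    fst  : ∀ {S T} → El (S ×ᵀ T ⇒ S)
    snd  : ∀ {S T} → El (S ×ᵀ T ⇒ T)
    inl  : ∀ {S T} → El (S ⇒ S +ᵀ T)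
    inr  : ∀ {S T} → El (T ⇒ S +ᵀ T)
    case : ∀ {S T U} → El ((S ⇒ U) ⇒ (T ⇒ U) ⇒ S +ᵀ T ⇒ U)
    zero : El Nᵀ
    succ : El (Nᵀ ⇒ Nᵀ)
    R    : ∀ {S} → El (S ⇒ (Nᵀ ⇒ S ⇒ S) ⇒ Nᵀ ⇒ S)
    k-β : ∀ {S T} (a : El S) (b : El T) → k · a · b ≡ a
    s-β : ∀ {S T U} (a : El (S ⇒ T ⇒ U)) (b : El (S ⇒ T)) (c : El S) →
          s · a · b · c ≡ a · c · (b · c)
    fst-β : ∀ {S T} (a : El S) (b : El T) → fst · (pair · a · b) ≡ a
    snd-β : ∀ {S T} (a : El S) (b : El T) → snd · (pair · a · b) ≡ b
    case-inl : ∀ {S T U} (a : El (S ⇒ U)) (b : El (T ⇒ U)) (x : El S) →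
               case · a · b · (inl · x) ≡ a · x
    case-inr : ∀ {S T U} (a : El (S ⇒ U)) (b : El (T ⇒ U)) (x : El T) →
               case · a · b · (inr · x) ≡ b · x
    R-zero : ∀ {S} (a : El S) (b : El (Nᵀ ⇒ S ⇒ S)) → R · a · b · zero ≡ a
    R-succ : ∀ {S} (a : El S) (b : El (Nᵀ ⇒ S ⇒ S)) (n : El Nᵀ) →
             R · a · b · (succ · n) ≡ b · n · (R · a · b · n)

Consistent : TCA → Set
Consistent 𝒯 = ¬ (zero ≡ succ · zero)
  where open TCA 𝒯

module ApTypes (𝒯 : TCA) where
  open TCA 𝒯

  -- a 𝒯-apartness type (A, T_A, T_A⁻, #_A); ap n a₀ a₁ means n : a₀ #_A a₁
  record ApType : Set₁ where
    field
      T T⁻ : Ty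
      A : El T → Set
      ap : El T⁻ → El T → El T → Set
      T⁻-inh : El T⁻
      A-inh : Σ (El T) A
      ap-A : ∀ {n a₀ a₁} → ap n a₀ a₁ → A a₀ × A a₁
      irrefl : ∀ {n a} → ¬ ap n a a
      symm : Σ[ σ ∈ El (T ⇒ T ⇒ T⁻ ⇒ T⁻) ]
               (∀ {a₀ a₁ n} → ap n a₀ a₁ → ap (σ · a₀ · a₁ · n) a₁ a₀)
      cotr : Σ[ τ ∈ El (T ⇒ T ⇒ T ⇒ T⁻ ⇒ T⁻ +ᵀ T⁻) ]
               (∀ {a₀ a₁ a₂ n} → ap n a₀ a₁ → A a₂ →
                  (Σ[ m ∈ El T⁻ ] (τ · a₀ · a₁ · a₂ · n ≡ inl · m × ap m a₀ a₂))
                ⊎ (Σ[ m ∈ El T⁻ ] (τ · a₀ · a₁ · a₂ · n ≡ inr · m × ap m a₁ a₂)))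

  open ApType public

  Sim : (X : ApType) → El (T X) → El (T X) → Set
  Sim X a₀ a₁ = ¬ (Σ[ n ∈ El (T⁻ X) ] ap X n a₀ a₁)

  record Premor (X Y : ApType) : Set where
    field
      real : El ((T X ⇒ T Y) ×ᵀ (T X ⇒ T X ⇒ T⁻ Y ⇒ T⁻ X))
      pres : ∀ {a} → A X a → A Y (fst · real · a)
      refl# : ∀ {a₀ a₁ n} → A X a₀ → A X a₁ →
              ap Y n (fst · real · a₀) (fst · real · a₁) →
              ap X (snd · real · a₀ · a₁ · n) a₀ a₁

  open Premor public

  -- identification of premorphisms (equality of morphisms of ApType)
  infix 4 _≈_
  _≈_ : ∀ {X Y} → Premor X Y → Premor X Y → Set
  _≈_ {X} {Y} f g = ∀ {a} → A X a → Sim Y (fst · real f · a) (fst · real g · a)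

  Bc : ∀ {P Q U} → El (Q ⇒ U) → El ((P ⇒ Q) ⇒ P ⇒ U)
  Bc {P} {Q} {U} u = s {P} {Q} {U} · (k · u)

  Bc-β : ∀ {P Q U} (u : El (Q ⇒ U)) (v : El (P ⇒ Q)) (x : El P) →
         Bc u · v · x ≡ u · (v · x)
  Bc-β u v x = trans (s-β (k · u) v x) (cong (_· (v · x)) (k-β u x))

  bc : ∀ {P Q U} → El ((Q ⇒ U) ⇒ (P ⇒ Q) ⇒ P ⇒ U)
  bc {P} {Q} {U} = Bc (s {P} {Q} {U}) · k

  bc-β : ∀ {P Q U} (u : El (Q ⇒ U)) → bc {P} {Q} {U} · u ≡ Bc u
  bc-β u = Bc-β s k u

  module Comp {X Y Z : ApType} (g : Premor Y Z) (f : Premor X Y) where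
    f₁ = fst · real f
    f₂ = snd · real f
    g₁ = fst · real g
    g₂ = snd · real g
    c₁ : El (T X ⇒ T Z)
    c₁ = Bc g₁ · f₁
    P̂ : El (T X ⇒ T X ⇒ (T⁻ Z ⇒ T⁻ Y) ⇒ T⁻ Z ⇒ T⁻ X)
    P̂ = Bc (Bc bc) · f₂
    Q̃ : El (T X ⇒ (T X ⇒ T Y) ⇒ T X ⇒ T⁻ Z ⇒ T⁻ Y)
    Q̃ = Bc bc · (Bc g₂ · f₁)
    Q̂ : El (T X ⇒ T X ⇒ T⁻ Z ⇒ T⁻ Y)
    Q̂ = s · Q̃ · (k · f₁)
    c₂ : El (T X ⇒ T X ⇒ T⁻ Z ⇒ T⁻ X)
    c₂ = s · (Bc s · P̂) · Q̂

    c₁-β : ∀ a → fst · (pair · c₁ · c₂) · a ≡ g₁ · (f₁ · a)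
    c₁-β a = trans (cong (_· a) (fst-β c₁ c₂)) (Bc-β g₁ f₁ a)

    c₂-β : ∀ a₀ a₁ n → snd · (pair · c₁ · c₂) · a₀ · a₁ · n ≡
                       f₂ · a₀ · a₁ · (g₂ · (f₁ · a₀) · (f₁ · a₁) · n)
    c₂-β a₀ a₁ n =
      begin
        snd · (pair · c₁ · c₂) · a₀ · a₁ · n
      ≡⟨ cong (λ z → z · a₀ · a₁ · n) (snd-β c₁ c₂) ⟩
        c₂ · a₀ · a₁ · n
      ≡⟨ cong (λ z → z · a₁ · n) (s-β (Bc s · P̂) Q̂ a₀) ⟩
        Bc s · P̂ · a₀ · (Q̂ · a₀) · a₁ · n
      ≡⟨ cong (λ z → z · (Q̂ · a₀) · a₁ · n) (Bc-β s P̂ a₀) ⟩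
        s · (P̂ · a₀) · (Q̂ · a₀) · a₁ · n
      ≡⟨ cong (_· n) (s-β (P̂ · a₀) (Q̂ · a₀) a₁) ⟩
        P̂ · a₀ · a₁ · (Q̂ · a₀ · a₁) · n
      ≡⟨ cong₂ (λ u v → u · v · n) Pβ Qβ ⟩
        Bc (f₂ · a₀ · a₁) · (g₂ · (f₁ · a₀) · (f₁ · a₁)) · n
      ≡⟨ Bc-β (f₂ · a₀ · a₁) (g₂ · (f₁ · a₀) · (f₁ · a₁)) n ⟩
        f₂ · a₀ · a₁ · (g₂ · (f₁ · a₀) · (f₁ · a₁) · n)
      ∎
      where
      open ≡-Reasoning
      Pβ : P̂ · a₀ · a₁ ≡ Bc (f₂ · a₀ · a₁)
      Pβ = trans (cong (_· a₁) (Bc-β (Bc bc) f₂ a₀))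
           (trans (Bc-β bc (f₂ · a₀) a₁) (bc-β (f₂ · a₀ · a₁)))
      Qβ : Q̂ · a₀ · a₁ ≡ g₂ · (f₁ · a₀) · (f₁ · a₁)
      Qβ = trans (cong (_· a₁) (trans (s-β Q̃ (k · f₁) a₀)
                   (trans (cong (Q̃ · a₀ ·_) (k-β f₁ a₀))
                   (cong (_· f₁) (trans (Bc-β bc (Bc g₂ · f₁) a₀)
                                        (trans (bc-β _) (cong Bc (Bc-β g₂ f₁ a₀))))))))
           (Bc-β (g₂ · (f₁ · a₀)) f₁ a₁)

    comp : Premor X Z
    comp = record
      { real = pair · c₁ · c₂
      ; pres = λ {a} Aa → subst (A Z) (sym (c₁-β a)) (pres g (pres f Aa))
      ; refl# = λ {a₀} {a₁} {n} A₀ A₁ w →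
          subst (λ z → ap X z a₀ a₁) (sym (c₂-β a₀ a₁ n))
            (refl# f A₀ A₁
              (refl# g (pres f A₀) (pres f A₁)
                (subst₂ (ap Z n) (c₁-β a₀) (c₁-β a₁) w)))
      }

  infixr 9 _∘_
  _∘_ : ∀ {X Y Z} → Premor Y Z → Premor X Y → Premor X Z
  g ∘ f = Comp.comp g f

  𝟙 : ApType
  𝟙 = record
    { T = ⊤ᵀ ; T⁻ = ⊤ᵀ ; A = λ x → x ≡ t ; ap = λ _ _ _ → ⊥
    ; T⁻-inh = t ; A-inh = t , refl ; ap-A = λ () ; irrefl = λ ()
    ; symm = k · (k · (k · t)) , λ ()
    ; cotr = k · (k · (k · (k · (inl · t)))) , λ () }

  -- |X| = Hom(1, X)
  Hom : ApType → Set
  Hom X = Premor 𝟙 X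

  pt : ∀ {X} (a : El (T X)) → A X a → Hom X
  pt {X} a Aa = record
    { real = pair · (k · a) · (k · (k · (k · t)))
    ; pres = λ {x} _ → subst (A X) (sym (e x)) Aa
    ; refl# = λ {a₀} {a₁} _ _ w → ⊥-elim (irrefl X (subst₂ (ap X _) (e a₀) (e a₁) w))
    }
    where
    e : ∀ x → fst · (pair · (k · a) · (k · (k · (k · t)))) · x ≡ a
    e x = trans (cong (_· x) (fst-β _ _)) (k-β a x)

  ⊤obj ⊥obj : ApType
  ⊤obj = 𝟙
  ⊥obj = 𝟙

  tᴬ : Hom ⊤obj
  tᴬ = pt t refl

  record CartesianClosed : Set₁ where
    infixr 7 _⊗_
    infixr 5 _⇨_
    field
      _⊗_ : ApType → ApType → ApType
      π₁ : ∀ {X Y} → Premor (X ⊗ Y) X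
      π₂ : ∀ {X Y} → Premor (X ⊗ Y) Y
      ⟨_,_⟩ : ∀ {Z X Y} → Premor Z X → Premor Z Y → Premor Z (X ⊗ Y)
      π₁-β : ∀ {Z X Y} (f : Premor Z X) (g : Premor Z Y) → π₁ ∘ ⟨ f , g ⟩ ≈ f
      π₂-β : ∀ {Z X Y} (f : Premor Z X) (g : Premor Z Y) → π₂ ∘ ⟨ f , g ⟩ ≈ g
      ⟨⟩-unique : ∀ {Z X Y} (f : Premor Z X) (g : Premor Z Y) (h : Premor Z (X ⊗ Y)) →
                  π₁ ∘ h ≈ f → π₂ ∘ h ≈ g → h ≈ ⟨ f , g ⟩
      _⇨_ : ApType → ApType → ApType
      ev : ∀ {X Y} → Premor ((X ⇨ Y) ⊗ X) Y
      cur : ∀ {Z X Y} → Premor (Z ⊗ X) Y → Premor Z (X ⇨ Y)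
      ev-β : ∀ {Z X Y} (g : Premor (Z ⊗ X) Y) → ev ∘ ⟨ cur g ∘ π₁ , π₂ ⟩ ≈ g
      cur-unique : ∀ {Z X Y} (g : Premor (Z ⊗ X) Y) (h : Premor Z (X ⇨ Y)) →
                   ev ∘ ⟨ h ∘ π₁ , π₂ ⟩ ≈ g → h ≈ cur g

  num : ℕ → El Nᵀ
  num zeroℕ = zero
  num (sucℕ n) = succ · num n

  𝔹 : Ty
  𝔹 = ⊤ᵀ +ᵀ ⊤ᵀ

  true false : El 𝔹
  true = inl · t
  false = inr · t

  e0 : El (Nᵀ ⇒ 𝔹)
  e0 = R · true · (k · (k · false))

  eS : El (Nᵀ ⇒ (Nᵀ ⇒ 𝔹) ⇒ Nᵀ ⇒ 𝔹)
  eS = k · (Bc (R · false) · Bc k)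

  eqN : El (Nᵀ ⇒ Nᵀ ⇒ 𝔹)
  eqN = R · e0 · eS

  H : ℕ → El (Nᵀ ⇒ 𝔹)
  H m = R · false · (Bc k · (eqN · num m))

  eqN-suc : ∀ m x → eqN · (succ · num m) · x ≡ H m · x
  eqN-suc m x = cong (_· x) (trans (R-succ e0 eS (num m))
                 (trans (cong (_· (eqN · num m)) (k-β _ (num m)))
                        (Bc-β (R · false) (Bc k) (eqN · num m))))

  H-zero : ∀ m → H m · zero ≡ false
  H-zero m = R-zero _ _

  H-succ : ∀ m x → H m · (succ · x) ≡ eqN · num m · x
  H-succ m x = trans (R-succ _ _ x)
                (trans (cong (_· (H m · x)) (Bc-β k (eqN · num m) x)) (k-β _ _))

  eqN-zero : ∀ x → eqN · zero · x ≡ e0 · x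
  eqN-zero x = cong (_· x) (R-zero _ _)

  eqN-yes : ∀ m → eqN · num m · num m ≡ true
  eqN-yes zeroℕ = trans (eqN-zero zero) (R-zero _ _)
  eqN-yes (sucℕ m) = trans (eqN-suc m _) (trans (H-succ m _) (eqN-yes m))

  eqN-no : ∀ m n → ¬ m ≡ n → eqN · num m · num n ≡ false
  eqN-no zeroℕ zeroℕ ne = ⊥-elim (ne refl)
  eqN-no zeroℕ (sucℕ n) ne = trans (eqN-zero _)
    (trans (R-succ _ _ _) (trans (cong (_· (e0 · num n)) (k-β (k · false) (num n))) (k-β false _)))
  eqN-no (sucℕ m) zeroℕ ne = trans (eqN-suc m _) (H-zero m)
  eqN-no (sucℕ m) (sucℕ n) ne =
    trans (eqN-suc m _) (trans (H-succ m _) (eqN-no m n (λ e → ne (cong sucℕ e))))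

  predᵀ : El (Nᵀ ⇒ Nᵀ)
  predᵀ = R · zero · k

  pred-β : ∀ x → predᵀ · (succ · x) ≡ x
  pred-β x = trans (R-succ _ _ x) (k-β _ _)

  isPos : El (Nᵀ ⇒ Nᵀ)
  isPos = R · zero · (k · (k · (succ · zero)))

  module _ (cons : Consistent 𝒯) where

    zero≢succ : ∀ x → ¬ (zero ≡ succ · x)
    zero≢succ x e = cons (trans (sym (R-zero _ _))
                           (trans (cong (isPos ·_) e)
                           (trans (R-succ _ _ x)
                           (trans (cong (_· (isPos · x)) (k-β (k · (succ · zero)) x)) (k-β _ _)))))

    num-inj : ∀ p q → num p ≡ num q → p ≡ q
    num-inj zeroℕ zeroℕ e = refl
    num-inj zeroℕ (sucℕ q) e = ⊥-elim (zero≢succ _ e)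
    num-inj (sucℕ p) zeroℕ e = ⊥-elim (zero≢succ _ (sym e))
    num-inj (sucℕ p) (sucℕ q) e =
      cong sucℕ (num-inj p q (trans (sym (pred-β _)) (trans (cong (predᵀ ·_) e) (pred-β _))))

    NumA : El Nᵀ → Set
    NumA a = Σ[ p ∈ ℕ ] a ≡ num p

    NumAp : El Nᵀ → El Nᵀ → El Nᵀ → Set
    NumAp _ a b = Σ[ p ∈ ℕ ] Σ[ q ∈ ℕ ] (a ≡ num p × b ≡ num q × ¬ p ≡ q)

    Cs : El (𝔹 ⇒ Nᵀ +ᵀ Nᵀ)
    Cs = case · (k · (inr · zero)) · (k · (inl · zero))

    E1 : El (Nᵀ ⇒ Nᵀ ⇒ Nᵀ +ᵀ Nᵀ)
    E1 = Bc (Bc Cs) · (Bc (s · eqN) · k)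

    E2 : El (Nᵀ ⇒ Nᵀ ⇒ Nᵀ ⇒ Nᵀ +ᵀ Nᵀ)
    E2 = Bc (Bc k) · E1

    τN : El (Nᵀ ⇒ Nᵀ ⇒ Nᵀ ⇒ Nᵀ ⇒ Nᵀ +ᵀ Nᵀ)
    τN = Bc k · E2

    τN-β : ∀ a₀ a₁ a₂ w → τN · a₀ · a₁ · a₂ · w ≡ Cs · (eqN · a₂ · a₀)
    τN-β a₀ a₁ a₂ w =
      trans (cong (λ z → z · a₁ · a₂ · w) (Bc-β k E2 a₀))
      (trans (cong (λ z → z · a₂ · w) (k-β _ a₁))
      (trans (cong (λ z → z · a₂ · w) (Bc-β (Bc k) E1 a₀))
      (trans (cong (_· w) (Bc-β k (E1 · a₀) a₂))
      (trans (k-β _ w)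
      (trans (cong (_· a₂) (Bc-β (Bc Cs) (Bc (s · eqN) · k) a₀))
      (trans (Bc-β Cs _ a₂)
      (cong (Cs ·_) (trans (cong (_· a₂) (Bc-β (s · eqN) k a₀))
                    (trans (s-β eqN (k · a₀) a₂) (cong (eqN · a₂ ·_) (k-β a₀ a₂)))))))))))

    Nobj : ApType
    Nobj = record
      { T = Nᵀ ; T⁻ = Nᵀ ; A = NumA ; ap = NumAp
      ; T⁻-inh = zero
      ; A-inh = zero , zeroℕ , refl
      ; ap-A = λ { (p , q , e₁ , e₂ , _) → (p , e₁) , (q , e₂) }
      ; irrefl = λ { (p , q , e₁ , e₂ , ne) → ne (num-inj p q (trans (sym e₁) e₂)) }
      ; symm = k · (k · (k · zero)) ,
               λ { (p , q , e₁ , e₂ , ne) → q , p , e₂ , e₁ , (λ e → ne (sym e)) }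
      ; cotr = τN , cotr-ok
      }
      where
      cotr-ok : ∀ {a₀ a₁ a₂ n} → NumAp n a₀ a₁ → NumA a₂ →
                (Σ[ m ∈ El Nᵀ ] (τN · a₀ · a₁ · a₂ · n ≡ inl · m × NumAp m a₀ a₂))
              ⊎ (Σ[ m ∈ El Nᵀ ] (τN · a₀ · a₁ · a₂ · n ≡ inr · m × NumAp m a₁ a₂))
      cotr-ok {a₀} {a₁} {a₂} {n} (p , q , e₀ , e₁ , ne) (r , e₂) with r ≟ p
      ... | yes r≡p = inj₂ (zero ,
              trans (τN-β a₀ a₁ a₂ n)
                (trans (cong (Cs ·_) (trans (cong₂ (λ u v → eqN · u · v) e₂ e₀)
                        (subst (λ z → eqN · num z · num p ≡ true) (sym r≡p) (eqN-yes p))))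
                (trans (case-inl _ _ t) (k-β _ t))) ,
              (q , r , e₁ , e₂ , λ e → ne (trans (sym r≡p) (sym e))))
      ... | no r≢p = inj₁ (zero ,
              trans (τN-β a₀ a₁ a₂ n)
                (trans (cong (Cs ·_) (trans (cong₂ (λ u v → eqN · u · v) e₂ e₀)
                        (eqN-no r p r≢p)))
                (trans (case-inr _ _ t) (k-β _ t))) ,
              (p , r , e₀ , e₂ , λ e → r≢p (sym e)))

    zeroN : Hom Nobj
    zeroN = pt zero (zeroℕ , refl)

    succN : Premor Nobj Nobj
    succN = record
      { real = pair · succ · (k · (k · (k · zero)))
      ; pres = λ { {a} (p , e) → sucℕ p , trans (cong (_· a) (fst-β _ _)) (cong (succ ·_) e) }
      ; refl# = λ { {a₀} {a₁} (p₀ , e₀) (p₁ , e₁) (p' , q' , e' , e'' , ne) →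
          p₀ , p₁ , e₀ , e₁ , λ p≡ → ne (num-inj p' q'
            (trans (sym e') (trans (cong (_· a₀) (fst-β _ _))
            (trans (cong (succ ·_) (trans e₀ (trans (cong num p≡) (sym e₁))))
            (trans (sym (cong (_· a₁) (fst-β _ _))) e''))))) }
      }

  module AsTCA (C : CartesianClosed) where
    open CartesianClosed C

    infixl 9 _·ᴬ_
    _·ᴬ_ : ∀ {X Y} → Hom (X ⇨ Y) → Hom X → Hom Y
    f ·ᴬ a = ev ∘ ⟨ f , a ⟩

    name : ∀ {X Y} → Premor X Y → Hom (X ⇨ Y)
    name g = cur (g ∘ π₂)

    fstᴬ : ∀ {X Y} → Hom (X ⊗ Y ⇨ X)
    fstᴬ = name π₁
    sndᴬ : ∀ {X Y} → Hom (X ⊗ Y ⇨ Y)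
    sndᴬ = name π₂

    Extensional : Set₁
    Extensional =
        (∀ {X Y} (x x' : Hom (X ⊗ Y)) →
           fstᴬ ·ᴬ x ≈ fstᴬ ·ᴬ x' → sndᴬ ·ᴬ x ≈ sndᴬ ·ᴬ x' → x ≈ x')
      × (∀ {X Y} (x x' : Hom (X ⇨ Y)) → (∀ y → x ·ᴬ y ≈ x' ·ᴬ y) → x ≈ x')
      × (∀ (x : Hom ⊤obj) → x ≈ tᴬ)

    module _ (cons : Consistent 𝒯) where
      succᴬ : Hom (Nobj cons ⇨ Nobj cons)
      succᴬ = name (succN cons)

      numeral : ℕ → Hom (Nobj cons)
      numeral zeroℕ = zeroN cons
      numeral (sucℕ n) = succᴬ ·ᴬ numeral n

      Standard : Set
      Standard = (∀ m n → numeral m ≈ numeral n → m ≡ n)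
               × (∀ (x : Hom (Nobj cons)) → Σ[ n ∈ ℕ ] numeral n ≈ x)

{-# OPTIONS --safe #-}
-- Two premorphisms are identified when their values are pointwise ∼, and ∼ is
-- an equivalence on the carrier by symmetry and cotransitivity of apartness.
-- Extensionality then comes from the universal properties of products and
-- exponentials plus well-pointedness: a premorphism is determined, up to
-- identification, by its composites with the global points pt a. For
-- standardness, the n-th numeral of ApType is realized up to ∼ by succⁿ 0,
-- distinct numerals of 𝒯 are apart in the natural numbers object, and every
-- global point of it is realized by some succⁿ 0. Finally ⊥ is interpreted by
-- the terminal object, whose point t inhabits |⊥|.
module Submission where

open import Defs
open import Data.Product using (_×_; _,_; proj₂; Σ-syntax)
open import Data.Sum using (inj₁; inj₂)
open import Data.Nat using (ℕ) renaming (zero to zeroℕ; suc to sucℕ)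
open import Data.Nat.Properties using (_≟_)
open import Level using (0ℓ)
open import Relation.Binary.Bundles using (Setoid)
open import Relation.Nullary.Decidable using (decidable-stable)
open import Relation.Binary.PropositionalEquality
import Relation.Binary.Reasoning.Setoid as SetoidReasoning

module _ (𝒯 : TCA) where
  open TCA 𝒯
  open ApTypes 𝒯

  ⟦_⟧ : ∀ {X Y} → Premor X Y → El (T X) → El (T Y)
  ⟦ f ⟧ a = fst · real f · a

  ∼-reflexive : ∀ X {a b} → a ≡ b → Sim X a b
  ∼-reflexive X refl (_ , a#a) = irrefl X a#a

  ∼-sym : ∀ X {a b} → Sim X a b → Sim X b a
  ∼-sym X a∼b (_ , b#a) = a∼b (_ , proj₂ (symm X) b#a)

  ∼-trans : ∀ X {a b c} → A X b → Sim X a b → Sim X b c → Sim X a c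
  ∼-trans X Ab a∼b b∼c (_ , a#c) with proj₂ (cotr X) a#c Ab
  ... | inj₁ (_ , _ , a#b) = a∼b (_ , a#b)
  ... | inj₂ (_ , _ , c#b) = b∼c (_ , proj₂ (symm X) c#b)

  ⟦⟧-resp-∼ : ∀ {X Y} (f : Premor X Y) {a₀ a₁} → A X a₀ → A X a₁ →
              Sim X a₀ a₁ → Sim Y (⟦ f ⟧ a₀) (⟦ f ⟧ a₁)
  ⟦⟧-resp-∼ f A₀ A₁ a₀∼a₁ (_ , fa₀#fa₁) = a₀∼a₁ (_ , refl# f A₀ A₁ fa₀#fa₁)

  -- Opaque, so that conversion checking compares the factors instead of
  -- unfolding the realizers of composites, which duplicate them.
  infixr 9 _⊙_
  opaque
    _⊙_ : ∀ {X Y Z} → Premor Y Z → Premor X Y → Premor X Z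
    _⊙_ = _∘_

    ⟦⊙⟧ : ∀ {X Y Z} (g : Premor Y Z) (f : Premor X Y) a → ⟦ g ⊙ f ⟧ a ≡ ⟦ g ⟧ (⟦ f ⟧ a)
    ⟦⊙⟧ = Comp.c₁-β

  ⟦pt⟧ : ∀ {X} a (Aa : A X a) x → ⟦ pt {X} a Aa ⟧ x ≡ a
  ⟦pt⟧ a Aa x = trans (cong (_· x) (fst-β _ _)) (k-β a x)

  -- A record, so that f and g can be inferred from a proof: _≈_ itself unfolds
  -- to a Π-type over the realizers, from which they cannot be recovered.
  infix 4 _≃_
  record _≃_ {X Y} (f g : Premor X Y) : Set where
    constructor identified
    field ≃⇒≈ : f ≈ g
  open _≃_

  ≃-setoid : ApType → ApType → Setoid 0ℓ 0ℓ
  ≃-setoid X Y = record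
    { Carrier = Premor X Y
    ; _≈_ = _≃_
    ; isEquivalence = record
      { refl = identified λ _ → ∼-reflexive Y refl
      ; sym = λ (identified f≈g) → identified λ Aa → ∼-sym Y (f≈g Aa)
      ; trans = λ {_} {g} (identified f≈g) (identified g≈h) →
                  identified λ Aa → ∼-trans Y (pres g Aa) (f≈g Aa) (g≈h Aa)
      }
    }

  module _ {X Y : ApType} where
    open Setoid (≃-setoid X Y) public
      using () renaming (refl to ≃-refl; sym to ≃-sym; trans to ≃-trans)

  module ≃-Reasoning {X Y : ApType} = SetoidReasoning (≃-setoid X Y)

  ⊙-assoc : ∀ {W X Y Z} (h : Premor Y Z) (g : Premor X Y) (f : Premor W X) →
            (h ⊙ g) ⊙ f ≃ h ⊙ (g ⊙ f)
  ⊙-assoc {Z = Z} h g f = identified λ {a} _ → ∼-reflexive Z (begin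
      ⟦ (h ⊙ g) ⊙ f ⟧ a       ≡⟨ ⟦⊙⟧ (h ⊙ g) f a ⟩
      ⟦ h ⊙ g ⟧ (⟦ f ⟧ a)     ≡⟨ ⟦⊙⟧ h g _ ⟩
      ⟦ h ⟧ (⟦ g ⟧ (⟦ f ⟧ a)) ≡⟨ cong ⟦ h ⟧ (⟦⊙⟧ g f a) ⟨
      ⟦ h ⟧ (⟦ g ⊙ f ⟧ a)     ≡⟨ ⟦⊙⟧ h (g ⊙ f) a ⟨
      ⟦ h ⊙ (g ⊙ f) ⟧ a       ∎)
    where open ≡-Reasoning

  ⊙-congˡ : ∀ {X Y Z} {g g' : Premor Y Z} (f : Premor X Y) → g ≃ g' → g ⊙ f ≃ g' ⊙ f
  ⊙-congˡ {Z = Z} {g} {g'} f (identified g≈g') = identified λ {a} Aa →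
    subst₂ (Sim Z) (sym (⟦⊙⟧ g f a)) (sym (⟦⊙⟧ g' f a)) (g≈g' (pres f Aa))

  ⊙-congʳ : ∀ {X Y Z} (g : Premor Y Z) {f f' : Premor X Y} → f ≃ f' → g ⊙ f ≃ g ⊙ f'
  ⊙-congʳ {Z = Z} g {f} {f'} (identified f≈f') = identified λ {a} Aa →
    subst₂ (Sim Z) (sym (⟦⊙⟧ g f a)) (sym (⟦⊙⟧ g f' a))
      (⟦⟧-resp-∼ g (pres f Aa) (pres f' Aa) (f≈f' Aa))

  ∼-at-t⇒≈ : ∀ {X} {x y : Hom X} → Sim X (⟦ x ⟧ t) (⟦ y ⟧ t) → x ≈ y
  ∼-at-t⇒≈ x∼y refl = x∼y

  ⊙-𝟙-identityʳ : ∀ {X} (h : Hom X) (u : Premor 𝟙 𝟙) → h ⊙ u ≃ h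
  ⊙-𝟙-identityʳ {X} h u = identified (∼-at-t⇒≈ {x = h ⊙ u} {h} (∼-reflexive X
    (trans (⟦⊙⟧ h u t) (cong ⟦ h ⟧ (pres u refl)))))

  well-pointed : ∀ {Z Y} (f g : Premor Z Y) → (∀ (p : Hom Z) → f ⊙ p ≃ g ⊙ p) → f ≃ g
  well-pointed {Z} {Y} f g f⊙p≃g⊙p = identified λ {a} Aa →
    subst₂ (Sim Y) (at a Aa f) (at a Aa g) (≃⇒≈ (f⊙p≃g⊙p (pt {Z} a Aa)) {t} refl)
    where
    at : ∀ a Aa h → ⟦ h ⊙ pt {Z} a Aa ⟧ t ≡ ⟦ h ⟧ a
    at a Aa h = trans (⟦⊙⟧ h (pt {Z} a Aa) t) (cong ⟦ h ⟧ (⟦pt⟧ {Z} a Aa t))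

  module _ (C : CartesianClosed) where
    open CartesianClosed C using (_⊗_; _⇨_; π₁; π₂; ⟨_,_⟩; ev; cur)
    open AsTCA C

    opaque
      unfolding _⊙_

      π₁-β : ∀ {Z X Y} (f : Premor Z X) (g : Premor Z Y) → π₁ ⊙ ⟨ f , g ⟩ ≃ f
      π₁-β f g = identified (CartesianClosed.π₁-β C f g)

      π₂-β : ∀ {Z X Y} (f : Premor Z X) (g : Premor Z Y) → π₂ ⊙ ⟨ f , g ⟩ ≃ g
      π₂-β f g = identified (CartesianClosed.π₂-β C f g)

      ⟨⟩-unique : ∀ {Z X Y} {f : Premor Z X} {g : Premor Z Y} (h : Premor Z (X ⊗ Y)) →
                  π₁ ⊙ h ≃ f → π₂ ⊙ h ≃ g → h ≃ ⟨ f , g ⟩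
      ⟨⟩-unique {f = f} {g} h (identified p) (identified q) =
        identified (CartesianClosed.⟨⟩-unique C f g h p q)

      ev-β : ∀ {Z X Y} (g : Premor (Z ⊗ X) Y) → ev ⊙ ⟨ cur g ⊙ π₁ , π₂ ⟩ ≃ g
      ev-β g = identified (CartesianClosed.ev-β C g)

      cur-unique : ∀ {Z X Y} {g : Premor (Z ⊗ X) Y} (h : Premor Z (X ⇨ Y)) →
                   ev ⊙ ⟨ h ⊙ π₁ , π₂ ⟩ ≃ g → h ≃ cur g
      cur-unique {g = g} h (identified p) = identified (CartesianClosed.cur-unique C g h p)

      ·ᴬ-≃ : ∀ {X Y} (z : Hom (X ⇨ Y)) (x : Hom X) → z ·ᴬ x ≃ ev ⊙ ⟨ z , x ⟩
      ·ᴬ-≃ z x = ≃-refl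

      name-≃ : ∀ {X Y} (g : Premor X Y) → name g ≃ cur (g ⊙ π₂)
      name-≃ g = ≃-refl

    ⟨⟩-cong : ∀ {Z X Y} {f f' : Premor Z X} {g g' : Premor Z Y} →
              f ≃ f' → g ≃ g' → ⟨ f , g ⟩ ≃ ⟨ f' , g' ⟩
    ⟨⟩-cong {f = f} {f'} {g} {g'} f≃f' g≃g' =
      ⟨⟩-unique ⟨ f , g ⟩ (≃-trans (π₁-β f g) f≃f') (≃-trans (π₂-β f g) g≃g')

    ⟨⟩-⊙ : ∀ {W Z X Y} (f : Premor Z X) (g : Premor Z Y) (p : Premor W Z) →
           ⟨ f , g ⟩ ⊙ p ≃ ⟨ f ⊙ p , g ⊙ p ⟩
    ⟨⟩-⊙ f g p = ⟨⟩-unique (⟨ f , g ⟩ ⊙ p)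
      (≃-trans (≃-sym (⊙-assoc π₁ ⟨ f , g ⟩ p)) (⊙-congˡ p (π₁-β f g)))
      (≃-trans (≃-sym (⊙-assoc π₂ ⟨ f , g ⟩ p)) (⊙-congˡ p (π₂-β f g)))

    uncurry : ∀ {X Y} → Hom (X ⇨ Y) → Premor (𝟙 ⊗ X) Y
    uncurry z = ev ⊙ ⟨ z ⊙ π₁ , π₂ ⟩

    uncurry-⊙ : ∀ {X Y} (z : Hom (X ⇨ Y)) (p : Hom (𝟙 ⊗ X)) →
                uncurry z ⊙ p ≃ ev ⊙ ⟨ z , π₂ ⊙ p ⟩
    uncurry-⊙ z p = begin
      uncurry z ⊙ p                   ≈⟨ ⊙-assoc ev ⟨ z ⊙ π₁ , π₂ ⟩ p ⟩
      ev ⊙ (⟨ z ⊙ π₁ , π₂ ⟩ ⊙ p)      ≈⟨ ⊙-congʳ ev (⟨⟩-⊙ (z ⊙ π₁) π₂ p) ⟩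
      ev ⊙ ⟨ (z ⊙ π₁) ⊙ p , π₂ ⊙ p ⟩  ≈⟨ ⊙-congʳ ev (⟨⟩-cong z⊙π₁⊙p≃z ≃-refl) ⟩
      ev ⊙ ⟨ z , π₂ ⊙ p ⟩             ∎
      where
      open ≃-Reasoning
      z⊙π₁⊙p≃z : (z ⊙ π₁) ⊙ p ≃ z
      z⊙π₁⊙p≃z = ≃-trans (⊙-assoc z π₁ p) (⊙-𝟙-identityʳ z (π₁ ⊙ p))

    name-·ᴬ : ∀ {X Y} (g : Premor X Y) (x : Hom X) → name g ·ᴬ x ≃ g ⊙ x
    name-·ᴬ {X} g x = begin
      name g ·ᴬ x                    ≈⟨ ·ᴬ-≃ (name g) x ⟩
      ev ⊙ ⟨ name g , x ⟩            ≈⟨ ⊙-congʳ ev (⟨⟩-cong (name-≃ g) (≃-sym (π₂-β tᴬ x))) ⟩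
      ev ⊙ ⟨ cur (g ⊙ π₂) , π₂ ⊙ ι ⟩ ≈⟨ ≃-sym (uncurry-⊙ (cur (g ⊙ π₂)) ι) ⟩
      uncurry (cur (g ⊙ π₂)) ⊙ ι     ≈⟨ ⊙-congˡ ι (ev-β (g ⊙ π₂)) ⟩
      (g ⊙ π₂) ⊙ ι                   ≈⟨ ⊙-assoc g π₂ ι ⟩
      g ⊙ (π₂ ⊙ ι)                   ≈⟨ ⊙-congʳ g (π₂-β tᴬ x) ⟩
      g ⊙ x                          ∎
      where
      open ≃-Reasoning
      ι : Hom (𝟙 ⊗ X)
      ι = ⟨ tᴬ , x ⟩

    product-extensional : ∀ {X Y} (x x' : Hom (X ⊗ Y)) →
      fstᴬ ·ᴬ x ≈ fstᴬ ·ᴬ x' → sndᴬ ·ᴬ x ≈ sndᴬ ·ᴬ x' → x ≈ x'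
    product-extensional x x' fst≈ snd≈ = ≃⇒≈ (begin
      x                      ≈⟨ ⟨⟩-unique x (component-≃ π₁ fst≈) (component-≃ π₂ snd≈) ⟩
      ⟨ π₁ ⊙ x' , π₂ ⊙ x' ⟩  ≈⟨ ≃-sym (⟨⟩-unique x' ≃-refl ≃-refl) ⟩
      x'                     ∎)
      where
      open ≃-Reasoning
      component-≃ : ∀ {Z} (π : Premor _ Z) → name π ·ᴬ x ≈ name π ·ᴬ x' → π ⊙ x ≃ π ⊙ x'
      component-≃ π e = ≃-trans (≃-sym (name-·ᴬ π x)) (≃-trans (identified e) (name-·ᴬ π x'))

    exponential-extensional : ∀ {X Y} (z z' : Hom (X ⇨ Y)) →
      (∀ x → z ·ᴬ x ≈ z' ·ᴬ x) → z ≈ z'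
    exponential-extensional z z' z·≈z'· = ≃⇒≈ (begin
      z                ≈⟨ cur-unique z ≃-refl ⟩
      cur (uncurry z)  ≈⟨ ≃-sym (cur-unique z' uncurry-z'≃uncurry-z) ⟩
      z'               ∎)
      where
      open ≃-Reasoning
      z⊙≃z'⊙ : ∀ x → ev ⊙ ⟨ z , x ⟩ ≃ ev ⊙ ⟨ z' , x ⟩
      z⊙≃z'⊙ x = ≃-trans (≃-sym (·ᴬ-≃ z x)) (≃-trans (identified (z·≈z'· x)) (·ᴬ-≃ z' x))
      uncurry-z'≃uncurry-z : uncurry z' ≃ uncurry z
      uncurry-z'≃uncurry-z = well-pointed (uncurry z') (uncurry z) λ p →
        ≃-trans (uncurry-⊙ z' p) (≃-trans (≃-sym (z⊙≃z'⊙ (π₂ ⊙ p))) (≃-sym (uncurry-⊙ z p)))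

    extensional : Extensional
    extensional = product-extensional , exponential-extensional , λ { _ _ (_ , ()) }

    module _ (cons : Consistent 𝒯) where
      private
        ℕobj : ApType
        ℕobj = Nobj cons

      num-∼⇒≡ : ∀ {m n} → Sim ℕobj (num m) (num n) → m ≡ n
      num-∼⇒≡ {m} {n} m∼n = decidable-stable (m ≟ n) λ m≢n →
        m∼n (zero , m , n , refl , refl , m≢n)

      numeral-∼ : ∀ n → Sim ℕobj (⟦ numeral cons n ⟧ t) (num n)
      numeral-∼ zeroℕ = ∼-reflexive ℕobj (⟦pt⟧ {ℕobj} zero (zeroℕ , refl) t)
      numeral-∼ (sucℕ n) =
        ∼-trans ℕobj (pres (succN cons ⊙ numeral cons n) refl)
          (≃⇒≈ (name-·ᴬ (succN cons) (numeral cons n)) refl)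
          (subst₂ (Sim ℕobj) (sym (⟦⊙⟧ (succN cons) (numeral cons n) t))
                             (cong (_· num n) (fst-β _ _))
            (⟦⟧-resp-∼ (succN cons) (pres (numeral cons n) refl) (n , refl) (numeral-∼ n)))

      standard : Standard cons
      standard = numeral-injective , numeral-surjective
        where
        numeral-injective : ∀ m n → numeral cons m ≈ numeral cons n → m ≡ n
        numeral-injective m n m≈n = num-∼⇒≡
          (∼-trans ℕobj (pres (numeral cons m) refl) (∼-sym ℕobj (numeral-∼ m))
            (∼-trans ℕobj (pres (numeral cons n) refl) (m≈n refl) (numeral-∼ n)))

        numeral-surjective : ∀ x → Σ[ n ∈ ℕ ] numeral cons n ≈ x
        numeral-surjective x with pres x refl
        ... | n , ⟦x⟧≡n = n , ∼-at-t⇒≈ {x = numeral cons n} {x}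
                (∼-trans ℕobj (n , refl) (numeral-∼ n) (∼-reflexive ℕobj (sym ⟦x⟧≡n)))

mainTheorem10 : (𝒯 : TCA) (cons : Consistent 𝒯) (C : ApTypes.CartesianClosed 𝒯) →
    ApTypes.AsTCA.Extensional 𝒯 C
    × ApTypes.AsTCA.Standard 𝒯 C cons
    × ApTypes.Hom 𝒯 (ApTypes.⊥obj 𝒯)
mainTheorem10 𝒯 cons C = extensional 𝒯 C , standard 𝒯 C cons , ApTypes.tᴬ 𝒯
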